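{- Suppose there exists a snug embedding of $K_n \times K_2$. Then the embedding restricted to either copy of $K_n$ has a cotriangular patchwork.
   Context: $K_n\times K_2$ is the $n$-prism: two copies of $K_n$ plus the $n$ matching edges joining corresponding vertices. Embeddings are cellular in closed orientable surfaces. An embedding of $K_n\times K_2$ is snug if every face incident with at least one matching edge is 4-sided and every other face is 3-sided. A facial cover of an embedded graph is a set of faces such that every vertex is incident with at least one of them; a cotriangular patchwork is a facial cover $F_c$ such that each vertex has exactly one incidence with the faces of $F_c$ and every face not in $F_c$ is triangular. -}

module Defs where

open import Data.Nat using (ℕ; zero; suc; _<_)
open import Data.Fin as Fin using (Fin)
open import Data.Bool as Bool using (Bool; not)
open import Data.Product using (Σ; ∃-syntax; _×_; _,_; proj₁; proj₂)
open import Data.Product.Properties using (≡-dec)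
open import Data.Sum using (_⊎_)
open import Relation.Binary.PropositionalEquality using (_≡_; _≢_)
open import Relation.Nullary using (¬_; yes; no)

iter : ∀ {A : Set} → (A → A) → ℕ → A → A
iter f zero x = x
iter f (suc k) x = f (iter f k x)

-- A rotation system on a simple graph (vertex type V, symmetric adjacency Adj):
-- for each vertex v, rot v is a cyclic permutation of the neighbours of v
-- (its values on non-neighbours are irrelevant).  Rotation systems encode
-- exactly the cellular embeddings in closed orientable surfaces.
record RotationSystem (V : Set) (Adj : V → V → Set) : Set where
  field
    rot     : V → V → V
    rot-adj : ∀ v u → Adj v u → Adj v (rot v u)
    rot-inj : ∀ v u w → Adj v u → Adj v w → rot v u ≡ rot v w → u ≡ w
    rot-cyc : ∀ v u w → Adj v u → Adj v w → ∃[ k ] (iter (rot v) k u ≡ w)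

-- Face-tracing permutation on darts (u , v): the next dart of the face is
-- (v , rot v u).  Faces = orbits of darts; corners at v = darts ending at v.
faceStep : ∀ {V : Set} → (V → V → V) → V × V → V × V
faceStep rot (u , v) = (v , rot v u)

HasPeriod : ∀ {A : Set} → (A → A) → ℕ → A → Set
HasPeriod f k d = (iter f k d ≡ d) × (∀ j → 0 < j → j < k → iter f j d ≢ d)

-- The prism K_n × K_2: vertices (i , b), i : Fin n, b : Bool (the copy)

PV : ℕ → Set
PV n = Fin n × Bool

PAdj : ∀ n → PV n → PV n → Set
PAdj n (i , a) (j , b) = ((a ≡ b) × (i ≢ j)) ⊎ ((i ≡ j) × (a ≢ b))

Matching : ∀ {n} → PV n × PV n → Set
Matching ((i , a) , (j , b)) = (i ≡ j) × (a ≢ b)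

Snug : ∀ n → RotationSystem (PV n) (PAdj n) → Set
Snug n R =
  ∀ u v → PAdj n u v →
    ((∃[ j ] Matching (iter (faceStep rot) j (u , v))) → HasPeriod (faceStep rot) 4 (u , v))
    × (¬ (∃[ j ] Matching (iter (faceStep rot) j (u , v))) → HasPeriod (faceStep rot) 3 (u , v))
  where open RotationSystem R

-- The rotation system induced on copy b of K_n: at vertex i, skip the
-- (unique) matching neighbour (i , not b).
inducedRot : ∀ n → RotationSystem (PV n) (PAdj n) → Bool → Fin n → Fin n → Fin n
inducedRot n R b i j with ≡-dec Fin._≟_ Bool._≟_ (RotationSystem.rot R (i , b) (j , b)) (i , not b)
... | yes _ = proj₁ (RotationSystem.rot R (i , b) (RotationSystem.rot R (i , b) (j , b)))
... | no _  = proj₁ (RotationSystem.rot R (i , b) (j , b))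

KAdj : ∀ n → Fin n → Fin n → Set
KAdj n i j = i ≢ j

-- A cotriangular patchwork for the embedding of K_n with rotation ρ:
-- a set S of faces (a set of darts closed under face tracing, i.e. a union
-- of faces) such that every vertex has exactly one incidence (corner) with
-- the faces in S, and every face not in S is triangular.
CotriangularPatchwork : ∀ n → (Fin n → Fin n → Fin n) → Set₁
CotriangularPatchwork n ρ =
  Σ (Fin n × Fin n → Set) λ S →
    (∀ u v → KAdj n u v → S (u , v) → S (faceStep ρ (u , v)))
    × (∀ u v → KAdj n u v → S (faceStep ρ (u , v)) → S (u , v))
    × (∀ v → ∃[ u ] (KAdj n u v × S (u , v)
                     × (∀ u' → KAdj n u' v → S (u' , v) → u' ≡ u)))
    × (∀ u v → KAdj n u v → ¬ S (u , v) → HasPeriod (faceStep ρ) 3 (u , v))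

-- In a snug embedding every face through a matching edge is a square
-- (v,b) (w,b) (w,¬b) (v,¬b), so at each vertex v of copy b the matching edge
-- is flanked by two copy-b neighbours u, w, and deleting the matching edges
-- merges the squares along copy b into faces of the induced embedding of K_n
-- that meet v exactly once, in the corner (u,v,w). These faces form the
-- patchwork; every other face of K_n never met a matching edge, hence was
-- already a triangle.
module Submission where

open import Defs
open import Data.Nat using (ℕ; zero; suc; _+_; _*_; _<_; NonZero; s≤s; z≤n)
open import Data.Nat.DivMod using (_%_; _/_; m≡m%n+[m/n]*n; m%n<n)
open import Data.Bool using (Bool; not)
open import Data.Bool.Properties using (not-¬; ¬-not; not-involutive)
open import Data.Fin using (Fin)
import Data.Fin as Fin
import Data.Bool as Bool
open import Data.Product using (∃-syntax; _×_; _,_; proj₁; proj₂)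
open import Data.Product.Properties using (≡-dec)
open import Data.Sum using (_⊎_; inj₁; inj₂)
open import Function using (_∘_)
open import Relation.Nullary using (¬_; yes; no; contradiction)
open import Relation.Binary.PropositionalEquality

iter-+ : ∀ {A : Set} (f : A → A) k m x → iter f (k + m) x ≡ iter f k (iter f m x)
iter-+ f zero    m x = refl
iter-+ f (suc k) m x = cong f (iter-+ f k m x)

iter-fixed : ∀ {A : Set} {f : A → A} {x} → f x ≡ x → ∀ k → iter f k x ≡ x
iter-fixed         fx≡x zero    = refl
iter-fixed {f = f} fx≡x (suc k) = trans (cong f (iter-fixed fx≡x k)) fx≡x

iter-*-period : ∀ {A : Set} (f : A → A) {k x} → iter f k x ≡ x → ∀ q → iter f (q * k) x ≡ x
iter-*-period f         per zero    = refl
iter-*-period f {k} {x} per (suc q) = begin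
  iter f (k + q * k) x         ≡⟨ iter-+ f k (q * k) x ⟩
  iter f k (iter f (q * k) x)  ≡⟨ cong (iter f k) (iter-*-period f per q) ⟩
  iter f k x                   ≡⟨ per ⟩
  x                            ∎
  where open ≡-Reasoning

orbit-invariant : ∀ {A : Set} (f : A → A) (P : A → Set) k .{{_ : NonZero k}} {x} →
                  iter f k x ≡ x → (∀ r → r < k → P (iter f r x)) → ∀ j → P (iter f j x)
orbit-invariant f P k {x} per initial j =
  subst (λ i → P (iter f i x)) (sym (m≡m%n+[m/n]*n j k))
        (subst P (sym reduce) (initial (j % k) (m%n<n j k)))
  where
  reduce : iter f (j % k + (j / k) * k) x ≡ iter f (j % k) x
  reduce = trans (iter-+ f (j % k) _ x) (cong (iter f (j % k)) (iter-*-period f per (j / k)))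

faceStep-period3 : ∀ {V : Set} (ρ : V → V → V) {p q r} →
                   iter (faceStep ρ) 3 (p , q) ≡ (p , q) → ρ q p ≡ r → ρ r q ≡ p × ρ p r ≡ q
faceStep-period3 ρ {p} {q} closed refl =
  cong proj₁ closed , trans (cong (λ y → ρ y (ρ q p)) (sym (cong proj₁ closed))) (cong proj₂ closed)

faceStep-period4 : ∀ {V : Set} (ρ : V → V → V) {p q r x} →
                   iter (faceStep ρ) 4 (p , q) ≡ (p , q) → ρ q p ≡ r → ρ r q ≡ x →
                   ρ x r ≡ p × ρ p x ≡ q
faceStep-period4 ρ {p} {q} closed refl refl =
  cong proj₁ closed , trans (cong (λ y → ρ y (ρ (ρ q p) q)) (sym (cong proj₁ closed))) (cong proj₂ closed)

faceStep-triangle : ∀ {V : Set} (ρ : V → V → V) {u v w} → u ≢ v → w ≢ u →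
                    ρ v u ≡ w → ρ w v ≡ u → ρ u w ≡ v → HasPeriod (faceStep ρ) 3 (u , v)
faceStep-triangle ρ {u} {v} u≢v w≢u ρvu ρwv ρuw = closed , minimal
  where
  closed : iter (faceStep ρ) 3 (u , v) ≡ (u , v)
  closed rewrite ρvu | ρwv | ρuw = refl
  minimal : ∀ j → 0 < j → j < 3 → iter (faceStep ρ) j (u , v) ≢ (u , v)
  minimal 1 _ _ e = u≢v (sym (cong proj₁ e))
  minimal 2 _ _ e = w≢u (trans (sym ρvu) (cong proj₁ e))
  minimal (suc (suc (suc _))) _ (s≤s (s≤s (s≤s ())))

module RotationProperties {V : Set} {Adj : V → V → Set} (R : RotationSystem V Adj) where
  open RotationSystem R

  iter-rot-adj : ∀ {v u} → Adj v u → ∀ k → Adj v (iter (rot v) k u)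
  iter-rot-adj     vu zero    = vu
  iter-rot-adj {v} vu (suc k) = rot-adj v _ (iter-rot-adj vu k)

  rot-fixed⇒sole-neighbour : ∀ {v u w} → Adj v u → Adj v w → rot v u ≡ u → w ≡ u
  rot-fixed⇒sole-neighbour {v} {u} {w} vu vw fixed with rot-cyc v u w vu vw
  ... | k , reach = trans (sym reach) (iter-fixed fixed k)

  rot-surjective : ∀ {v w} → Adj v w → ∃[ u ] (Adj v u × rot v u ≡ w)
  rot-surjective {v} {w} vw with rot-cyc v (rot v w) w (rot-adj v w vw) vw
  ... | zero  , fixed = w , vw , fixed
  ... | suc k , reach = iter (rot v) k (rot v w) , iter-rot-adj (rot-adj v w vw) k , reach

module _ {n : ℕ} where

  PAdj-sym : ∀ {p q : PV n} → PAdj n p q → PAdj n q p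
  PAdj-sym {_ , _} {_ , _} (inj₁ (a≡c , i≢j)) = inj₁ (sym a≡c , i≢j ∘ sym)
  PAdj-sym {_ , _} {_ , _} (inj₂ (i≡j , a≢c)) = inj₂ (sym i≡j , a≢c ∘ sym)

  PAdj-along : ∀ {i j : Fin n} a → i ≢ j → PAdj n (i , a) (j , a)
  PAdj-along a i≢j = inj₁ (refl , i≢j)

  PAdj-across : ∀ (i : Fin n) a → PAdj n (i , a) (i , not a)
  PAdj-across i a = inj₂ (refl , not-¬ refl)

  PAdj-view : ∀ {v : Fin n} {a q} → PAdj n (v , a) q →
              (∃[ x ] (v ≢ x × q ≡ (x , a))) ⊎ q ≡ (v , not a)
  PAdj-view {q = x , c} (inj₁ (a≡c , v≢x)) = inj₁ (x , v≢x , cong (x ,_) (sym a≡c))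
  PAdj-view {q = x , c} (inj₂ (v≡x , a≢c)) = inj₂ (cong₂ _,_ (sym v≡x) (¬-not (a≢c ∘ sym)))

  PAdj-across⇒≡ : ∀ {v w : Fin n} {a c} → a ≢ c → PAdj n (v , a) (w , c) → v ≡ w
  PAdj-across⇒≡ a≢c (inj₁ (a≡c , _)) = contradiction a≡c a≢c
  PAdj-across⇒≡ a≢c (inj₂ (v≡w , _)) = v≡w

module PrismRotation {n : ℕ} (R : RotationSystem (PV n) (PAdj n)) where
  open RotationSystem R
  open RotationProperties R public

  rot-back-adj : ∀ {p q} → PAdj n p q → PAdj n (rot p q) p
  rot-back-adj {p} {q} pq = PAdj-sym (rot-adj p q pq)

  rot-along-moves : ∀ {u v : Fin n} a → u ≢ v → rot (v , a) (u , a) ≢ (u , a)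
  rot-along-moves {u} {v} a u≢v fixed = not-¬ refl (sym (cong proj₂ sole))
    where
    sole : (v , not a) ≡ (u , a)
    sole = rot-fixed⇒sole-neighbour (PAdj-along a (u≢v ∘ sym)) (PAdj-across v a) fixed

  inducedRot-along : ∀ b {i j k} → rot (i , b) (j , b) ≡ (k , b) → inducedRot n R b i j ≡ k
  inducedRot-along b {i} {j} next with ≡-dec Fin._≟_ Bool._≟_ (rot (i , b) (j , b)) (i , not b)
  ... | yes across = contradiction (cong proj₂ (trans (sym next) across)) (not-¬ refl)
  ... | no _       = cong proj₁ next

  inducedRot-across : ∀ b {i j} → rot (i , b) (j , b) ≡ (i , not b) →
                      inducedRot n R b i j ≡ proj₁ (rot (i , b) (i , not b))
  inducedRot-across b {i} {j} across with ≡-dec Fin._≟_ Bool._≟_ (rot (i , b) (j , b)) (i , not b)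
  ... | yes _     = cong (λ q → proj₁ (rot (i , b) q)) across
  ... | no along = contradiction across along

module SnugRotation {n : ℕ} (R : RotationSystem (PV n) (PAdj n)) (snug : Snug n R) where
  open RotationSystem R
  open PrismRotation R public

  matching-face-period4 : ∀ {p q} → PAdj n p q → ∃[ j ] Matching (iter (faceStep rot) j (p , q)) →
                          HasPeriod (faceStep rot) 4 (p , q)
  matching-face-period4 pq = proj₁ (snug _ _ pq)

  unmatched-face-period3 : ∀ {p q} → PAdj n p q → ¬ (∃[ j ] Matching (iter (faceStep rot) j (p , q))) →
                           HasPeriod (faceStep rot) 3 (p , q)
  unmatched-face-period3 pq = proj₂ (snug _ _ pq)

  rot-across-moves : ∀ (v : Fin n) a → rot (v , a) (v , not a) ≢ (v , not a)
  rot-across-moves v a fixed with PAdj-view (rot-adj (v , not a) (v , a) (PAdj-sym (PAdj-across v a)))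
  ... | inj₁ (x , v≢x , _) =
    not-¬ refl (cong proj₂ (rot-fixed⇒sole-neighbour (PAdj-across v a) (PAdj-along a v≢x) fixed))
  ... | inj₂ back = proj₂ period 2 (s≤s z≤n) (s≤s (s≤s (s≤s z≤n))) returns
    where
    period : HasPeriod (faceStep rot) 4 ((v , not a) , (v , a))
    period = matching-face-period4 (PAdj-sym (PAdj-across v a)) (0 , refl , not-¬ refl ∘ sym)
    returns : iter (faceStep rot) 2 ((v , not a) , (v , a)) ≡ ((v , not a) , (v , a))
    returns = cong₂ _,_ fixed
      (trans (cong (λ p → rot p (v , a)) fixed) (trans back (cong (v ,_) (not-involutive a))))

  -- In both square lemmas the fourth corner x of the square is a common
  -- neighbour of some (v,c) and (w,¬c), so x is (v,¬c) or (w,c); one of the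
  -- two would be a fixed point of rot, which rot-along-moves and
  -- rot-across-moves exclude.
  follows-across⇒precedes-across : ∀ {v w : Fin n} a → v ≢ w → rot (v , a) (v , not a) ≡ (w , a) →
                                   rot (w , a) (v , a) ≡ (w , not a)
  follows-across⇒precedes-across {v} {w} a v≢w next
    with PAdj-view (rot-adj (w , a) (v , a) (PAdj-along a (v≢w ∘ sym)))
  ... | inj₂ across = across
  ... | inj₁ (z , _ , x≡za) = contradiction (trans x≡za (cong (_, a) z≡v)) (rot-along-moves a v≢w)
    where
    x : PV n
    x = rot (w , a) (v , a)
    closes : rot x (w , a) ≡ (v , not a)
    closes = proj₁ (faceStep-period4 rot (proj₁ (matching-face-period4 (PAdj-sym (PAdj-across v a))
                                                   (0 , refl , not-¬ refl ∘ sym))) next refl)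
    z≡v : z ≡ v
    z≡v = PAdj-across⇒≡ (not-¬ refl)
            (subst₂ (PAdj n) x≡za closes (rot-adj x (w , a) (rot-back-adj (PAdj-along a (v≢w ∘ sym)))))

  precedes-across⇒follows-across : ∀ {v w : Fin n} a → v ≢ w → rot (w , a) (v , a) ≡ (w , not a) →
                                   rot (v , a) (v , not a) ≡ (w , a)
  precedes-across⇒follows-across {v} {w} a v≢w patch
    with PAdj-view (rot-adj (w , not a) (w , a) (PAdj-sym (PAdj-across w a)))
  ... | inj₂ back = contradiction (subst (λ c → rot (w , not a) (w , c) ≡ (w , not (not a)))
                                         (sym (not-involutive a)) back)
                                  (rot-across-moves w (not a))
  ... | inj₁ (z , _ , x≡z) = trans (cong (rot (v , a)) (sym x≡v)) (proj₂ closes)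
    where
    x : PV n
    x = rot (w , not a) (w , a)
    period : HasPeriod (faceStep rot) 4 ((v , a) , (w , a))
    period = matching-face-period4 (PAdj-along a v≢w)
               (1 , subst (λ q → Matching ((w , a) , q)) (sym patch) (refl , not-¬ refl))
    closes : rot x (w , not a) ≡ (v , a) × rot (v , a) x ≡ (w , a)
    closes = faceStep-period4 rot (proj₁ period) patch refl
    x≡v : x ≡ (v , not a)
    x≡v = trans x≡z (cong (_, not a) (PAdj-across⇒≡ (not-¬ refl ∘ sym)
            (subst₂ (PAdj n) x≡z (proj₁ closes)
              (rot-adj x (w , not a) (rot-back-adj (PAdj-sym (PAdj-across w a)))))))

  InCopy : Bool → PV n × PV n → Set
  InCopy a d = proj₂ (proj₁ d) ≡ a × proj₂ (proj₂ d) ≡ a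

  InCopy⇒¬Matching : ∀ {a} d → InCopy a d → ¬ Matching d
  InCopy⇒¬Matching ((_ , c) , (_ , c')) (c≡a , c'≡a) (_ , c≢c') = c≢c' (trans c≡a (sym c'≡a))

  along-face-no-matching : ∀ {u v w : Fin n} a → u ≢ v → v ≢ w → rot (v , a) (u , a) ≡ (w , a) →
                           ¬ (∃[ j ] Matching (iter (faceStep rot) j ((u , a) , (v , a))))
  along-face-no-matching {u} {v} {w} a u≢v v≢w next (j , matching) =
    InCopy⇒¬Matching _ (orbit-invariant (faceStep rot) (InCopy a) 4 period first-four j) matching
    where
    period : iter (faceStep rot) 4 ((u , a) , (v , a)) ≡ ((u , a) , (v , a))
    period = proj₁ (matching-face-period4 (PAdj-along a u≢v) (j , matching))
    x : PV n
    x = rot (w , a) (v , a)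
    wv : PAdj n (w , a) (v , a)
    wv = PAdj-along a (v≢w ∘ sym)
    closes : rot x (w , a) ≡ (u , a)
    closes = proj₁ (faceStep-period4 rot period next refl)
    x-in-copy : proj₂ x ≡ a
    x-in-copy with PAdj-view (rot-adj (w , a) (v , a) wv)
    ... | inj₁ (_ , _ , x≡za) = cong proj₂ x≡za
    ... | inj₂ x≡across = contradiction (trans next (cong (_, a) w≡u)) (rot-along-moves a u≢v)
      where
      w≡u : w ≡ u
      w≡u = PAdj-across⇒≡ (not-¬ refl ∘ sym)
              (subst₂ (PAdj n) x≡across closes (rot-adj x (w , a) (rot-back-adj wv)))
    first-four : ∀ r → r < 4 → InCopy a (iter (faceStep rot) r ((u , a) , (v , a)))
    first-four 0 _ = refl , refl
    first-four 1 _ = refl , cong proj₂ next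
    first-four 2 _ rewrite next = refl , x-in-copy
    first-four 3 _ rewrite next = x-in-copy , cong proj₂ closes
    first-four (suc (suc (suc (suc _)))) (s≤s (s≤s (s≤s (s≤s ()))))

  along-triangle : ∀ {u v w : Fin n} a → u ≢ v → v ≢ w → rot (v , a) (u , a) ≡ (w , a) →
                   rot (w , a) (v , a) ≡ (u , a) × rot (u , a) (w , a) ≡ (v , a)
  along-triangle a u≢v v≢w next =
    faceStep-period3 rot
      (proj₁ (unmatched-face-period3 (PAdj-along a u≢v) (along-face-no-matching a u≢v v≢w next))) next

module Patchwork {n : ℕ} (R : RotationSystem (PV n) (PAdj n)) (snug : Snug n R) (b : Bool) where
  open RotationSystem R
  open SnugRotation R snug

  ρ : Fin n → Fin n → Fin n
  ρ = inducedRot n R b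

  Patch : Fin n × Fin n → Set
  Patch (u , v) = rot (v , b) (u , b) ≡ (v , not b)

  patch-step : ∀ u v → Patch (u , v) → Patch (faceStep ρ (u , v))
  patch-step u v patch with PAdj-view (rot-adj (v , b) (v , not b) (PAdj-across v b))
  ... | inj₂ fixed = contradiction fixed (rot-across-moves v b)
  ... | inj₁ (w , v≢w , next) =
    subst (λ t → Patch (v , t)) (sym ρvu≡w) (follows-across⇒precedes-across b v≢w next)
    where
    ρvu≡w : ρ v u ≡ w
    ρvu≡w = trans (inducedRot-across b patch) (cong proj₁ next)

  patch-step⁻¹ : ∀ u v → u ≢ v → Patch (faceStep ρ (u , v)) → Patch (u , v)
  patch-step⁻¹ u v u≢v patch′ with PAdj-view (rot-adj (v , b) (u , b) (PAdj-along b (u≢v ∘ sym)))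
  ... | inj₂ patch = patch
  ... | inj₁ (w , v≢w , next) = contradiction (cong proj₂ u≡across) (not-¬ refl)
    where
    after : rot (v , b) (v , not b) ≡ (w , b)
    after = precedes-across⇒follows-across b v≢w
              (subst (λ t → Patch (v , t)) (inducedRot-along b next) patch′)
    u≡across : (u , b) ≡ (v , not b)
    u≡across = rot-inj (v , b) (u , b) (v , not b) (PAdj-along b (u≢v ∘ sym)) (PAdj-across v b)
                 (trans next (sym after))

  patch-corner : ∀ v → ∃[ u ] (u ≢ v × Patch (u , v) × (∀ u′ → u′ ≢ v → Patch (u′ , v) → u′ ≡ u))
  patch-corner v with rot-surjective (PAdj-across v b)
  ... | p , vp , p↦across with PAdj-view vp
  ...   | inj₂ p≡across = contradiction (subst (λ q → rot (v , b) q ≡ (v , not b)) p≡across p↦across)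
                                        (rot-across-moves v b)
  ...   | inj₁ (u , v≢u , p≡u) = u , v≢u ∘ sym , patch , unique
    where
    patch : Patch (u , v)
    patch = subst (λ q → rot (v , b) q ≡ (v , not b)) p≡u p↦across
    unique : ∀ u′ → u′ ≢ v → Patch (u′ , v) → u′ ≡ u
    unique u′ u′≢v patch′ = cong proj₁ (rot-inj (v , b) (u′ , b) (u , b)
      (PAdj-along b (u′≢v ∘ sym)) (PAdj-along b v≢u) (trans patch′ (sym patch)))

  nonpatch-triangle : ∀ u v → u ≢ v → ¬ Patch (u , v) → HasPeriod (faceStep ρ) 3 (u , v)
  nonpatch-triangle u v u≢v ¬patch with PAdj-view (rot-adj (v , b) (u , b) (PAdj-along b (u≢v ∘ sym)))
  ... | inj₂ patch = contradiction patch ¬patch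
  ... | inj₁ (w , v≢w , next) =
    faceStep-triangle ρ u≢v w≢u (inducedRot-along b next)
      (inducedRot-along b (proj₁ triangle)) (inducedRot-along b (proj₂ triangle))
    where
    triangle : rot (w , b) (v , b) ≡ (u , b) × rot (u , b) (w , b) ≡ (v , b)
    triangle = along-triangle b u≢v v≢w next
    w≢u : w ≢ u
    w≢u w≡u = rot-along-moves b u≢v (trans next (cong (_, b) w≡u))

proposition4p1 : ∀ n (R : RotationSystem (PV n) (PAdj n)) → Snug n R →
                   ∀ (b : Bool) → CotriangularPatchwork n (inducedRot n R b)
proposition4p1 n R snug b =
  Patch , (λ u v _ → patch-step u v) , patch-step⁻¹ , patch-corner , nonpatch-triangle
  where open Patchwork R snug b
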